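{- Let $q\ge3$ be odd and let $\mathbf f\in A_q^+$ be a forbidden factor whose last symbol is $0$ and which does not induce zero periodicity on $A_q^\infty$. Let $\mathbf p\in A_q^*(\mathbf f)$ be such that one of the $\triangleleft$-first or the $\triangleleft$-last word of $\mathbf p|A_q^\infty(\mathbf f)$ does not have ultimate period $0$, and let $\mathbf a$ be this word. Then there is $m\ge0$ such that either $\mathbf a=\mathbf p0^i(10^m)^\infty$ for some $i\le m$, or $\mathbf a=\mathbf p(q-1)(0^m1)^\infty$.
   Context: $A_q=\{0,1,\dots,q-1\}$. $A_q^*$ (resp. $A_q^+$) is the set of all (resp. nonempty) finite words, $A_q^\infty$ the right-infinite words; $\mathbf a^i$ is $i$-fold concatenation, $\mathbf a^\infty=\mathbf a\mathbf a\cdots$. For a set $X$ of words, $X(\mathbf f)$ is the set of words of $X$ not containing $\mathbf f$ as a factor (contiguous subword), $\mathbf p|X$ the words of $X$ with prefix $\mathbf p$. An infinite word has ultimate period $\mathbf c\ne\epsilon$ if it equals $\mathbf b\mathbf c^\infty$ for a finite $\mathbf b$. For distinct words $\mathbf s,\mathbf t$ of the same (finite or infinite) length, with $k$ the leftmost differing position, $u=\sum_{i<k}s_i$ and $v$ the number of nonzero symbols among $s_1,\dots,s_{k-1}$, $\mathbf s\triangleleft\mathbf t$ iff ($u+v$ even and $s_k<t_k$) or ($u+v$ odd and $s_k>t_k$); $\triangleleft$-first/last mean least/greatest. For odd $q$, $\mathbf f$ induces zero periodicity on $A_q^\infty$ if for every $\mathbf p\in A_q^*(\mathbf f)$ the $\triangleleft$-first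 and $\triangleleft$-last words of $\mathbf p|A_q^\infty(\mathbf f)$ both have ultimate period $0$. -}

module Defs where

open import Data.Nat using (ℕ; zero; suc; _+_; _≤_; _<_; _%_; _≡ᵇ_)
open import Data.Nat.DivMod using (m%n<n)
open import Data.Bool using (if_then_else_)
open import Data.Fin using (fromℕ<)
open import Data.List using (List; []; _∷_; length; lookup)
open import Data.List.Relation.Unary.All using (All)
open import Data.List.Relation.Binary.Infix.Heterogeneous using (Infix)
open import Data.Product using (_×_; ∃-syntax)
open import Data.Sum using (_⊎_)
open import Relation.Binary.PropositionalEquality using (_≡_)
open import Relation.Nullary using (¬_)

-- Letters of A_q are natural numbers < q.
-- Finite words are lists; infinite (right-infinite) words are functions ℕ → ℕ
-- (positions indexed from 0).
Word : Set
Word = List ℕ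

InfWord : Set
InfWord = ℕ → ℕ

Odd : ℕ → Set
Odd n = n % 2 ≡ 1

Even : ℕ → Set
Even n = n % 2 ≡ 0

InAlph : ℕ → InfWord → Set
InAlph q a = ∀ n → a n < q

_≐_ : InfWord → InfWord → Set
a ≐ b = ∀ n → a n ≡ b n

sumUpTo : InfWord → ℕ → ℕ
sumUpTo s zero = 0
sumUpTo s (suc k) = sumUpTo s k + s k

nzCount : InfWord → ℕ → ℕ
nzCount s zero = 0
nzCount s (suc k) = nzCount s k + (if s k ≡ᵇ 0 then 0 else 1)

_◁_ : InfWord → InfWord → Set
s ◁ t = ∃[ k ] ((∀ i → i < k → s i ≡ t i) ×
          ((Even (sumUpTo s k + nzCount s k) × s k < t k) ⊎
           (Odd (sumUpTo s k + nzCount s k) × t k < s k)))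

HasPrefix : Word → InfWord → Set
HasPrefix p a = ∀ i (lt : i < length p) → a i ≡ lookup p (fromℕ< lt)

OccursAt : Word → InfWord → ℕ → Set
OccursAt f a i = ∀ j (lt : j < length f) → a (i + j) ≡ lookup f (fromℕ< lt)

Avoids : Word → InfWord → Set
Avoids f a = ∀ i → ¬ OccursAt f a i

FinAvoid : ℕ → Word → Word → Set
FinAvoid q f p = All (_< q) p × ¬ Infix _≡_ f p

Cyl : ℕ → Word → Word → InfWord → Set
Cyl q f p a = InAlph q a × HasPrefix p a × Avoids f a

IsFirst : ℕ → Word → Word → InfWord → Set
IsFirst q f p a = Cyl q f p a × (∀ b → Cyl q f p b → ¬ (a ≐ b) → a ◁ b)

IsLast : ℕ → Word → Word → InfWord → Set
IsLast q f p a = Cyl q f p a × (∀ b → Cyl q f p b → ¬ (a ≐ b) → b ◁ a)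

UltPer0 : InfWord → Set
UltPer0 a = ∃[ n ] (∀ k → n ≤ k → a k ≡ 0)

InducesZeroPeriodicity : ℕ → Word → Set
InducesZeroPeriodicity q f =
  ∀ p → FinAvoid q f p → ∀ a →
    (IsFirst q f p a → UltPer0 a) × (IsLast q f p a → UltPer0 a)

_++ω_ : Word → InfWord → InfWord
([] ++ω w) n = w n
((x ∷ p) ++ω w) zero = x
((x ∷ p) ++ω w) (suc n) = (p ++ω w) n

-- c^∞ for a nonempty word c (the value on [] is an unused junk value)
cycleω : Word → InfWord
cycleω [] n = 0
cycleω (c ∷ cs) n = lookup (c ∷ cs) (fromℕ< (m%n<n n (suc (length cs))))

module Submission where

open import Defs
open import Data.Nat using (ℕ; _≤_; _<_; _∸_)
open import Data.List using (List; []; _∷_; _++_; [_]; replicate)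
open import Data.List.Relation.Unary.All using (All)
open import Data.Product using (_×_; ∃-syntax)
open import Data.Sum using (_⊎_)
open import Relation.Binary.PropositionalEquality using (_≡_)
open import Relation.Nullary using (¬_)

open import Data.Nat
open import Data.Nat.Properties
open import Data.Nat.DivMod using (_/_; m%n<n; m≡m%n+[m/n]*n; [m+kn]%n≡m%n; m<n⇒m%n≡m; %-distribˡ-+)
open import Data.Nat.Induction using (<-rec)
open import Data.Nat.Tactic.RingSolver using (solve-∀)
open import Data.Bool using (if_then_else_)
open import Data.Fin using (fromℕ<)
open import Data.List using (length; lookup)
open import Data.List.Properties using (length-++; length-replicate)
open import Data.Product using (_,_; proj₁; proj₂)
open import Data.Sum using (inj₁; inj₂; [_,_]′)
open import Data.Empty using (⊥; ⊥-elim)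
open import Function using (_∘_)
open import Relation.Binary using (Tri; tri<; tri≈; tri>)
open import Relation.Binary.PropositionalEquality hiding ([_])
open import Relation.Nullary using (yes; no)
open import Relation.Nullary.Decidable using (decidable-stable)

-- Write q = k + 3 and f = g 0, and let a be the ◁-first or ◁-last word of
-- p|A_q^∞(f), not ultimately 0.  Whether a ◁-beats a word branching off at n is decided by
-- the parity of the weight of a at n (letter sum plus number of nonzero letters before n)
-- and by a being first or last; accordingly a prefers small or large letters at n.  The
-- words  a₀ ⋯ a_{n-1} d c c ⋯  with n ≥ |p| and c ≠ 0 stay in the cylinder, since f ends
-- in 0, unless d = 0 completes f.  Comparing a with them shows: where small letters are
-- preferred a n ∈ {0,1}, and a n = 1 only right after an occurrence of g; where large
-- letters are preferred a n = q - 1.  The letters 0, 1 have even weight and keep the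
-- preference, q - 1 has odd weight q and switches it to small, so a is binary after |p|
-- or |p| + 1.  Writing g = u 0^m (u empty or ending in x ≠ 0), a has no m + 1 consecutive
-- zeros there (they are f itself, or propagate and make a ultimately 0), so every 1 is
-- followed by exactly m zeros and a 1.  Hence a = p 0^t (1 0^m)^∞ or a = p (q-1) (0^m 1)^∞.

-- Total lookup into a finite word (0 outside its range).
at : Word → ℕ → ℕ
at []       _       = 0
at (x ∷ xs) zero    = x
at (x ∷ xs) (suc k) = at xs k

lookup≡at : ∀ xs k (lt : k < length xs) → lookup xs (fromℕ< lt) ≡ at xs k
lookup≡at (x ∷ xs) zero    lt        = refl
lookup≡at (x ∷ xs) (suc k) (s≤s lt) = lookup≡at xs k lt

at-replicate : ∀ m x k → k < m → at (replicate m x) k ≡ x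
at-replicate (suc m) x zero    _        = refl
at-replicate (suc m) x (suc k) (s≤s lt) = at-replicate m x k lt

shift : ℕ → InfWord → InfWord
shift i w j = w (i + j)

record Prefix (u : Word) (w : InfWord) : Set where
  constructor prefix
  field letter : ∀ j → j < length u → w j ≡ at u j
open Prefix public

Prefix-∷ : ∀ {x u w} → w 0 ≡ x → Prefix u (shift 1 w) → Prefix (x ∷ u) w
Prefix-∷ {u = u} {w} w0 pre = prefix letters
  where
  letters : ∀ j → j < suc (length u) → w j ≡ at (_ ∷ u) j
  letters zero    _        = w0
  letters (suc j) (s≤s lt) = letter pre j lt

Prefix-head : ∀ {x u w} → Prefix (x ∷ u) w → w 0 ≡ x
Prefix-head pre = letter pre 0 (s≤s z≤n)

Prefix-tail : ∀ {x u w} → Prefix (x ∷ u) w → Prefix u (shift 1 w)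
Prefix-tail pre = prefix λ j lt → letter pre (suc j) (s≤s lt)

Prefix-++ : ∀ u {v w} → Prefix u w → Prefix v (shift (length u) w) → Prefix (u ++ v) w
Prefix-++ []      preU preV = preV
Prefix-++ (x ∷ u) preU preV = Prefix-∷ (Prefix-head preU) (Prefix-++ u (Prefix-tail preU) preV)

Prefix-++ˡ : ∀ u {v w} → Prefix (u ++ v) w → Prefix u w
Prefix-++ˡ []      pre = prefix λ _ ()
Prefix-++ˡ (x ∷ u) pre = Prefix-∷ (Prefix-head pre) (Prefix-++ˡ u (Prefix-tail pre))

Prefix-++ʳ : ∀ u {v w} → Prefix (u ++ v) w → Prefix v (shift (length u) w)
Prefix-++ʳ []      pre = pre
Prefix-++ʳ (x ∷ u) pre = Prefix-++ʳ u (Prefix-tail pre)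

Prefix-replicate⁺ : ∀ m {x w} → (∀ j → j < m → w j ≡ x) → Prefix (replicate m x) w
Prefix-replicate⁺ m {x} run = prefix λ j lt →
  let lt′ = subst (j <_) (length-replicate m) lt in trans (run j lt′) (sym (at-replicate m x j lt′))

Prefix-replicate⁻ : ∀ m {x w} → Prefix (replicate m x) w → ∀ j → j < m → w j ≡ x
Prefix-replicate⁻ m {x} pre j lt =
  trans (letter pre j (subst (j <_) (sym (length-replicate m)) lt)) (at-replicate m x j lt)

Prefix-agree : ∀ {u w w′} → (∀ j → j < length u → w j ≡ w′ j) → Prefix u w → Prefix u w′
Prefix-agree agree pre = prefix λ j lt → trans (sym (agree j lt)) (letter pre j lt)

hasPrefix⇒Prefix : ∀ {u w} → HasPrefix u w → Prefix u w
hasPrefix⇒Prefix {u} pre = prefix λ j lt → trans (pre j lt) (lookup≡at u j lt)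

occursAt⇒Prefix : ∀ {u} w i → OccursAt u w i → Prefix u (shift i w)
occursAt⇒Prefix {u} w i occ = prefix λ j lt → trans (occ j lt) (lookup≡at u j lt)

Prefix⇒occursAt : ∀ {u} w i → Prefix u (shift i w) → OccursAt u w i
Prefix⇒occursAt {u} w i pre j lt = trans (letter pre j lt) (sym (lookup≡at u j lt))

≐-sym : ∀ {v w} → v ≐ w → w ≐ v
≐-sym eq n = sym (eq n)

≐-trans : ∀ {u v w} → u ≐ v → v ≐ w → u ≐ w
≐-trans eq eq′ n = trans (eq n) (eq′ n)

≐-++ω : ∀ u {v w} → Prefix u w → shift (length u) w ≐ v → w ≐ (u ++ω v)
≐-++ω []      pre rest n       = rest n
≐-++ω (x ∷ u) pre rest zero    = Prefix-head pre
≐-++ω (x ∷ u) pre rest (suc n) = ≐-++ω u (Prefix-tail pre) rest n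

Prefix-≐ : ∀ {u v w} → v ≐ w → Prefix u v → Prefix u w
Prefix-≐ eq = Prefix-agree (λ j _ → eq j)

shift-shift : ∀ i j (w : InfWord) → shift j (shift i w) ≐ shift (i + j) w
shift-shift i j w n = cong w (sym (+-assoc i j n))

shift-cong : ∀ {i j} w → i ≡ j → shift i w ≐ shift j w
shift-cong w i≡j n = cong (λ i → w (i + n)) i≡j

shift-comm : ∀ i j (w : InfWord) → shift j (shift i w) ≐ shift i (shift j w)
shift-comm i j w n = cong w (trans (sym (+-assoc i j n)) (trans (cong (_+ n) (+-comm i j)) (+-assoc j i n)))

cycleω-at : ∀ c {m} → length c ≡ suc m → ∀ n → cycleω c n ≡ at c (n % suc m)
cycleω-at (x ∷ xs) refl n = lookup≡at (x ∷ xs) (n % suc (length xs)) (m%n<n n (suc (length xs)))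

cycleω-block : ∀ c {m} → length c ≡ suc m → ∀ t → Prefix c (shift (t * suc m) (cycleω c))
cycleω-block c {m} len t = prefix λ j lt → begin
  cycleω c (t * suc m + j)        ≡⟨ cycleω-at c len (t * suc m + j) ⟩
  at c ((t * suc m + j) % suc m)  ≡⟨ cong (λ n → at c (n % suc m)) (+-comm (t * suc m) j) ⟩
  at c ((j + t * suc m) % suc m)  ≡⟨ cong (at c) ([m+kn]%n≡m%n j t (suc m)) ⟩
  at c (j % suc m)                ≡⟨ cong (at c) (m<n⇒m%n≡m (subst (j <_) len lt)) ⟩
  at c j                          ∎
  where open ≡-Reasoning

≐-cycleω : ∀ c {m w} → length c ≡ suc m → (∀ t → Prefix c (shift (t * suc m) w)) → w ≐ cycleω c
≐-cycleω c {m} {w} len blocks n = begin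
  w n                    ≡⟨ cong w (trans (m≡m%n+[m/n]*n n (suc m)) (+-comm r (t * suc m))) ⟩
  w (t * suc m + r)      ≡⟨ letter (blocks t) r (subst (r <_) (sym len) (m%n<n n (suc m))) ⟩
  at c r                 ≡⟨ sym (cycleω-at c len n) ⟩
  cycleω c n             ∎
  where
  open ≡-Reasoning
  r = n % suc m
  t = n / suc m

cycleω-rotate : ∀ u v {m} → length (u ++ v) ≡ suc m → (u ++ω cycleω (v ++ u)) ≐ cycleω (u ++ v)
cycleω-rotate u v {m} len = ≐-sym (≐-++ω u (Prefix-++ˡ u (block 0)) rotated)
  where
  block = cycleω-block (u ++ v) len
  len′ : length (v ++ u) ≡ suc m
  len′ = trans (length-++ v) (trans (+-comm (length v) (length u)) (trans (sym (length-++ u)) len))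
  next-block : ∀ t j → length u + (t * suc m + (length v + j)) ≡ suc t * suc m + j
  next-block t j = subst (λ ℓ → length u + (t * ℓ + (length v + j)) ≡ suc t * ℓ + j)
                     (trans (sym (length-++ u)) len) (arith (length u) (length v) t j)
    where
    arith : ∀ a b t j → a + (t * (a + b) + (b + j)) ≡ suc t * (a + b) + j
    arith = solve-∀
  rotated : shift (length u) (cycleω (u ++ v)) ≐ cycleω (v ++ u)
  rotated = ≐-cycleω (v ++ u) len′ λ t →
    Prefix-++ v
      (Prefix-≐ (shift-comm (t * suc m) (length u) (cycleω (u ++ v))) (Prefix-++ʳ u (block t)))
      (Prefix-≐ (λ j → cong (cycleω (u ++ v)) (sym (next-block t j))) (Prefix-++ˡ u (block (suc t))))

first-one : ∀ d {w} → (∀ j → w j ≡ 0 ⊎ w j ≡ 1) →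
  Prefix (replicate d 0) w ⊎ ∃[ t ] (t < d × Prefix (replicate t 0) w × w t ≡ 1)
first-one zero    binary = inj₁ (prefix λ _ ())
first-one (suc d) {w} binary with binary 0
... | inj₂ w0≡1 = inj₂ (0 , s≤s z≤n , prefix (λ _ ()) , w0≡1)
... | inj₁ w0≡0 with first-one d {shift 1 w} (λ j → binary (suc j))
...   | inj₁ zeros = inj₁ (Prefix-∷ w0≡0 zeros)
...   | inj₂ (t , t<d , zeros , one) = inj₂ (suc t , s≤s t<d , Prefix-∷ w0≡0 zeros , one)

even-odd : ∀ x → Even x → Odd x → ⊥
even-odd x e o with trans (sym e) o
... | ()

even-or-odd : ∀ x → Even x ⊎ Odd x
even-or-odd x = lemma (x % 2) (m%n<n x 2)
  where
  lemma : ∀ r → r < 2 → r ≡ 0 ⊎ r ≡ 1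
  lemma zero          _                = inj₁ refl
  lemma (suc zero)    _                = inj₂ refl
  lemma (suc (suc r)) (s≤s (s≤s ()))

even+even : ∀ x y → Even x → Even y → Even (x + y)
even+even x y ex ey = trans (%-distribˡ-+ x y 2) (cong₂ (λ r s → (r + s) % 2) ex ey)

odd+even : ∀ x y → Odd x → Even y → Odd (x + y)
odd+even x y ox ey = trans (%-distribˡ-+ x y 2) (cong₂ (λ r s → (r + s) % 2) ox ey)

even+odd : ∀ x y → Even x → Odd y → Odd (x + y)
even+odd x y ex oy = trans (%-distribˡ-+ x y 2) (cong₂ (λ r s → (r + s) % 2) ex oy)

odd+odd : ∀ x y → Odd x → Odd y → Even (x + y)
odd+odd x y ox oy = trans (%-distribˡ-+ x y 2) (cong₂ (λ r s → (r + s) % 2) ox oy)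

weight : InfWord → ℕ → ℕ
weight s n = sumUpTo s n + nzCount s n

nonzero : ℕ → ℕ
nonzero x = if x ≡ᵇ 0 then 0 else 1

weight-suc : ∀ s n → weight s (suc n) ≡ weight s n + (s n + nonzero (s n))
weight-suc s n = swap (sumUpTo s n) (s n) (nzCount s n) (nonzero (s n))
  where
  swap : ∀ x y z w → (x + y) + (z + w) ≡ (x + z) + (y + w)
  swap = solve-∀

AgreeBelow : InfWord → InfWord → ℕ → Set
AgreeBelow s t n = ∀ i → i < n → s i ≡ t i

agree-sym : ∀ {s t n} → AgreeBelow s t n → AgreeBelow t s n
agree-sym agree i lt = sym (agree i lt)

agree-pred : ∀ {s t n} → AgreeBelow s t (suc n) → AgreeBelow s t n
agree-pred agree i lt = agree i (m<n⇒m<1+n lt)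

weight-agree : ∀ {s t} n → AgreeBelow s t n → weight s n ≡ weight t n
weight-agree n agree = cong₂ _+_ (sums n agree) (counts n agree)
  where
  sums : ∀ {s t} n → AgreeBelow s t n → sumUpTo s n ≡ sumUpTo t n
  sums zero    _     = refl
  sums (suc n) agree = cong₂ _+_ (sums n (agree-pred agree)) (agree n (n<1+n n))
  counts : ∀ {s t} n → AgreeBelow s t n → nzCount s n ≡ nzCount t n
  counts zero    _     = refl
  counts (suc n) agree =
    cong₂ (λ c x → c + nonzero x) (counts n (agree-pred agree)) (agree n (n<1+n n))

◁-at : ∀ {s t n} → s ◁ t → AgreeBelow s t n → s n ≢ t n →
  (Even (weight s n) × s n < t n) ⊎ (Odd (weight s n) × t n < s n)
◁-at {n = n} (k , agreeₖ , decision) agree neq with <-cmp k n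
... | tri≈ _ refl _ = decision
... | tri> _ _ n<k  = ⊥-elim (neq (agreeₖ n n<k))
... | tri< k<n _ _ with decision
...   | inj₁ (_ , lt) = ⊥-elim (<⇒≢ lt (agree k k<n))
...   | inj₂ (_ , lt) = ⊥-elim (<⇒≢ lt (sym (agree k k<n)))

module Extremal {q : ℕ} {f p : Word} {a : InfWord} where

  first-decides : ∀ {b n} → IsFirst q f p a → Cyl q f p b → AgreeBelow a b n → a n ≢ b n →
    (Even (weight a n) × a n < b n) ⊎ (Odd (weight a n) × b n < a n)
  first-decides {b} {n} (_ , least) cyl agree neq = ◁-at (least b cyl (λ eq → neq (eq n))) agree neq

  last-decides : ∀ {b n} → IsLast q f p a → Cyl q f p b → AgreeBelow a b n → a n ≢ b n →
    (Even (weight a n) × b n < a n) ⊎ (Odd (weight a n) × a n < b n)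
  last-decides {b} {n} (_ , greatest) cyl agree neq
    rewrite weight-agree n agree
    = ◁-at (greatest b cyl (λ eq → neq (eq n))) (agree-sym agree) (neq ∘ sym)

  -- At n the extremal word a wants its letter as small (resp. large) as possible.
  Small : ℕ → Set
  Small n = (IsFirst q f p a × Even (weight a n)) ⊎ (IsLast q f p a × Odd (weight a n))

  Large : ℕ → Set
  Large n = (IsFirst q f p a × Odd (weight a n)) ⊎ (IsLast q f p a × Even (weight a n))

  small-or-large : IsFirst q f p a ⊎ IsLast q f p a → ∀ n → Small n ⊎ Large n
  small-or-large (inj₁ first) n with even-or-odd (weight a n)
  ... | inj₁ even = inj₁ (inj₁ (first , even))
  ... | inj₂ odd  = inj₂ (inj₁ (first , odd))
  small-or-large (inj₂ last) n with even-or-odd (weight a n)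
  ... | inj₁ even = inj₂ (inj₂ (last , even))
  ... | inj₂ odd  = inj₁ (inj₂ (last , odd))

  small-minimal : ∀ {b n} → Small n → Cyl q f p b → AgreeBelow a b n → a n ≤ b n
  small-minimal {b} {n} small cyl agree = ≮⇒≥ λ b<a → beats small (≢-sym (<⇒≢ b<a)) b<a
    where
    beats : Small n → a n ≢ b n → b n < a n → ⊥
    beats (inj₁ (first , even)) neq b<a with first-decides first cyl agree neq
    ... | inj₁ (_ , a<b)  = <-asym a<b b<a
    ... | inj₂ (odd , _)  = even-odd (weight a n) even odd
    beats (inj₂ (last , odd)) neq b<a with last-decides last cyl agree neq
    ... | inj₁ (even , _) = even-odd (weight a n) even odd
    ... | inj₂ (_ , a<b)  = <-asym a<b b<a

  large-maximal : ∀ {b n} → Large n → Cyl q f p b → AgreeBelow a b n → b n ≤ a n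
  large-maximal {b} {n} large cyl agree = ≮⇒≥ λ a<b → beats large (<⇒≢ a<b) a<b
    where
    beats : Large n → a n ≢ b n → a n < b n → ⊥
    beats (inj₁ (first , odd)) neq a<b with first-decides first cyl agree neq
    ... | inj₁ (even , _) = even-odd (weight a n) even odd
    ... | inj₂ (_ , b<a)  = <-asym a<b b<a
    beats (inj₂ (last , even)) neq a<b with last-decides last cyl agree neq
    ... | inj₁ (_ , b<a)  = <-asym a<b b<a
    ... | inj₂ (odd , _)  = even-odd (weight a n) even odd

  small-step : ∀ {n} → Even (a n + nonzero (a n)) → Small n → Small (suc n)
  small-step {n} e (inj₁ (first , even)) =
    inj₁ (first , subst Even (sym (weight-suc a n)) (even+even (weight a n) _ even e))
  small-step {n} e (inj₂ (last , odd)) =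
    inj₂ (last , subst Odd (sym (weight-suc a n)) (odd+even (weight a n) _ odd e))

  large-step : ∀ {n} → Odd (a n + nonzero (a n)) → Large n → Small (suc n)
  large-step {n} o (inj₁ (first , odd)) =
    inj₁ (first , subst Even (sym (weight-suc a n)) (odd+odd (weight a n) _ odd o))
  large-step {n} o (inj₂ (last , even)) =
    inj₂ (last , subst Odd (sym (weight-suc a n)) (even+odd (weight a n) _ even o))

graft : InfWord → ℕ → ℕ → ℕ → InfWord
graft a n d c k with <-cmp k n
... | tri< _ _ _ = a k
... | tri≈ _ _ _ = d
... | tri> _ _ _ = c

graft-below : ∀ a {n d c k} → k < n → graft a n d c k ≡ a k
graft-below a {n} {k = k} k<n with <-cmp k n
... | tri< _ _ _    = refl
... | tri≈ _ k≡n _  = ⊥-elim (<⇒≢ k<n k≡n)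
... | tri> _ _ n<k  = ⊥-elim (<-asym k<n n<k)

graft-at : ∀ a n d c → graft a n d c n ≡ d
graft-at a n d c with <-cmp n n
... | tri< n<n _ _ = ⊥-elim (<-irrefl refl n<n)
... | tri≈ _ _ _   = refl
... | tri> _ _ n<n = ⊥-elim (<-irrefl refl n<n)

graft-above : ∀ a {n d c k} → n < k → graft a n d c k ≡ c
graft-above a {n} {k = k} n<k with <-cmp k n
... | tri< k<n _ _ = ⊥-elim (<-asym k<n n<k)
... | tri≈ _ k≡n _ = ⊥-elim (<⇒≢ n<k (sym k≡n))
... | tri> _ _ _   = refl

graft-agrees : ∀ a n d c → AgreeBelow a (graft a n d c) n
graft-agrees a n d c k k<n = sym (graft-below a k<n)

record EndsAt (u : Word) (w : InfWord) (n : ℕ) : Set where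
  constructor occurrence
  field
    start   : ℕ
    reaches : start + length u ≡ n
    occurs  : Prefix u (shift start w)

-- A forbidden factor ending in 0 can only appear in the competitor if it ends at the
-- branching letter d = 0; so if g does not end at n in a (or d ≠ 0), the competitor
-- stays in the cylinder.
graft-Cyl : ∀ {q g p a n d c} → Cyl q (g ++ [ 0 ]) p a → length p ≤ n → d < q → c < q → c ≢ 0 →
  (d ≡ 0 → ¬ EndsAt g a n) → Cyl q (g ++ [ 0 ]) p (graft a n d c)
graft-Cyl {q} {g} {p} {a} {n} {d} {c} (alphabet , starts , avoids) p≤n d<q c<q c≢0 ends =
  alphabet′ , prefix′ , avoids′
  where
  b = graft a n d c

  alphabet′ : InAlph q b
  alphabet′ k with <-cmp k n
  ... | tri< _ _ _ = alphabet k
  ... | tri≈ _ _ _ = d<q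
  ... | tri> _ _ _ = c<q

  prefix′ : HasPrefix p b
  prefix′ k k<p = trans (graft-below a (<-≤-trans k<p p≤n)) (starts k k<p)

  avoids′ : Avoids (g ++ [ 0 ]) b
  avoids′ i occurs = placed (<-cmp (i + length g) n)
    where
    pre : Prefix (g ++ [ 0 ]) (shift i b)
    pre = occursAt⇒Prefix b i occurs
    zero-at-end : b (i + length g) ≡ 0
    zero-at-end = trans (cong (λ j → b (i + j)) (sym (+-identityʳ (length g)))) (letter (Prefix-++ʳ g pre) 0 (s≤s z≤n))
    placed : Tri (i + length g < n) (i + length g ≡ n) (n < i + length g) → ⊥
    -- the occurrence lies in the part copied from a
    placed (tri< end<n _ _) = avoids i (Prefix⇒occursAt a i (Prefix-agree {g ++ [ 0 ]} inside pre))
      where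
      inside : ∀ j → j < length (g ++ [ 0 ]) → shift i b j ≡ shift i a j
      inside j j<len = graft-below a (≤-<-trans (+-monoʳ-≤ i j≤g) end<n)
        where j≤g = ≤-pred (subst (j <_) (trans (length-++ g) (+-comm (length g) 1)) j<len)
    -- the final 0 of f is the branching letter d, preceded by an occurrence of g in a
    placed (tri≈ _ end≡n _) = ends d≡0 (occurrence i end≡n (Prefix-agree inside (Prefix-++ˡ g pre)))
      where
      d≡0 : d ≡ 0
      d≡0 = trans (sym (graft-at a n d c)) (subst (λ k → b k ≡ 0) end≡n zero-at-end)
      inside : ∀ j → j < length g → shift i b j ≡ shift i a j
      inside j j<g = graft-below a (subst (i + j <_) end≡n (+-monoʳ-< i j<g))
    -- the final 0 of f would be a letter c ≠ 0
    placed (tri> _ _ n<end) = c≢0 (trans (sym (graft-above a n<end)) zero-at-end)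

+-length-++ : ∀ i u {v : Word} → i + length u + length v ≡ i + length (u ++ v)
+-length-++ i u {v} = trans (+-assoc i (length u) (length v)) (cong (i +_) (sym (length-++ u)))

ends-suffix : ∀ u {v w n} → EndsAt (u ++ v) w n → EndsAt v w n
ends-suffix u {v} {w} (occurrence i end pre) =
  occurrence (i + length u) (trans (+-length-++ i u) end)
    (Prefix-≐ (shift-shift i (length u) w) (Prefix-++ʳ u pre))

ends-prefix : ∀ u {v w n} → EndsAt (u ++ v) w (n + length v) → EndsAt u w n
ends-prefix u {v} (occurrence i end pre) =
  occurrence i (+-cancelʳ-≡ (length v) (i + length u) _ (trans (+-length-++ i u) end)) (Prefix-++ˡ u pre)

ends-replicate : ∀ m {x w k j} → EndsAt (replicate m x) w (k + suc j) → j < m → w k ≡ x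
ends-replicate m {x} {w} {k} {j} (occurrence i end pre) j<m =
  trans (cong w (sym start≡k)) (Prefix-replicate⁻ m pre r r<m)
  where
  r = m ∸ suc j
  r<m : r < m
  r<m = ∸-monoʳ-< (s≤s z≤n) j<m
  start≡k : i + r ≡ k
  start≡k = +-cancelʳ-≡ (suc j) (i + r) k (begin
    i + r + suc j    ≡⟨ +-assoc i r (suc j) ⟩
    i + (r + suc j)  ≡⟨ cong (i +_) (m∸n+n≡m j<m) ⟩
    i + m            ≡⟨ cong (i +_) (sym (length-replicate m)) ⟩
    i + length (replicate m x) ≡⟨ end ⟩
    k + suc j        ∎)
    where open ≡-Reasoning

replicate-∷ʳ : ∀ m (x : ℕ) → replicate m x ++ [ x ] ≡ x ∷ replicate m x
replicate-∷ʳ zero    x = refl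
replicate-∷ʳ (suc m) x = cong (x ∷_) (replicate-∷ʳ m x)

LastNonzero : Word → Set
LastNonzero u = u ≡ [] ⊎ ∃[ h ] ∃[ x ] (x ≢ 0 × u ≡ h ++ [ x ])

trailing-zeros : ∀ g → ∃[ m ] ∃[ u ] (g ≡ u ++ replicate m 0 × LastNonzero u)
trailing-zeros [] = 0 , [] , refl , inj₁ refl
trailing-zeros (y ∷ g) with trailing-zeros g
... | m , u , refl , inj₂ (h , x , x≢0 , refl) = m , y ∷ u , refl , inj₂ (y ∷ h , x , x≢0 , refl)
... | m , [] , refl , inj₁ refl with y ≟ 0
...   | yes refl = suc m , [] , refl , inj₁ refl
...   | no y≢0   = m , [ y ] , refl , inj₂ ([] , y , y≢0 , refl)

ends-marker : ∀ h x m {w k} → EndsAt ((h ++ [ x ]) ++ replicate m 0) w (k + suc m) → w k ≡ x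
ends-marker h x m {w} {k} ends =
  ends-replicate 1 (ends-suffix h (ends-prefix (h ++ [ x ]) (subst (EndsAt _ w) position ends))) (s≤s z≤n)
  where
  position : k + suc m ≡ k + 1 + length (replicate m 0)
  position = trans (cong (k +_) (cong suc (sym (length-replicate m)))) (sym (+-assoc k 1 _))

module Dynamics (k : ℕ) (odd-q : Odd (3 + k)) (u : Word) (m : ℕ) (u-shape : LastNonzero u)
  (p : Word) (a : InfWord)
  (extremal : IsFirst (3 + k) ((u ++ replicate m 0) ++ [ 0 ]) p a ⊎ IsLast (3 + k) ((u ++ replicate m 0) ++ [ 0 ]) p a)
  (not-ultimately-0 : ¬ UltPer0 a) where

  q Q : ℕ
  q = 3 + k
  Q = 2 + k

  g : Word
  g = u ++ replicate m 0

  open Extremal {q} {g ++ [ 0 ]} {p} {a}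

  cyl : Cyl q (g ++ [ 0 ]) p a
  cyl = [ proj₁ , proj₁ ]′ extremal

  P : ℕ
  P = length p

  competitor : ∀ {n d c} → P ≤ n → d < q → c < q → c ≢ 0 → (d ≡ 0 → ¬ EndsAt g a n) →
    Cyl q (g ++ [ 0 ]) p (graft a n d c)
  competitor = graft-Cyl {q} {g} {p} {a} cyl

  small-binary : ∀ {n} → Small n → P ≤ n → a n ≡ 0 ⊎ a n ≡ 1
  small-binary {n} small p≤n = binary (a n) (subst (a n ≤_) (graft-at a n 1 1) a≤1)
    where
    1<q : 1 < q
    1<q = s≤s (s≤s z≤n)
    a≤1 = small-minimal small (competitor p≤n 1<q 1<q (λ ()) (λ ())) (graft-agrees a n 1 1)
    binary : ∀ x → x ≤ 1 → x ≡ 0 ⊎ x ≡ 1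
    binary zero          _             = inj₁ refl
    binary (suc zero)    _             = inj₂ refl
    binary (suc (suc _)) (s≤s ())

  large-top : ∀ {n} → Large n → P ≤ n → a n ≡ Q
  large-top {n} large p≤n = ≤-antisym (≤-pred (proj₁ cyl n)) (subst (_≤ a n) (graft-at a n Q Q) Q≤a)
    where
    Q≤a = large-maximal large (competitor p≤n ≤-refl ≤-refl (λ ()) (λ ())) (graft-agrees a n Q Q)

  small-ends : ∀ {n} → Small n → P ≤ n → a n ≢ 0 → ¬ ¬ EndsAt g a n
  small-ends {n} small p≤n a≢0 no-end = a≢0 (n≤0⇒n≡0 (subst (a n ≤_) (graft-at a n 0 1) a≤0))
    where
    a≤0 = small-minimal small (competitor p≤n (s≤s z≤n) (s≤s (s≤s z≤n)) (λ ()) (λ _ → no-end)) (graft-agrees a n 0 1)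

  small-keeps : ∀ {n} → Small n → a n ≡ 0 ⊎ a n ≡ 1 → Small (suc n)
  small-keeps small (inj₁ a≡0) = small-step (subst (λ x → Even (x + nonzero x)) (sym a≡0) refl) small
  small-keeps small (inj₂ a≡1) = small-step (subst (λ x → Even (x + nonzero x)) (sym a≡1) refl) small

  large-switches : ∀ {n} → Large n → a n ≡ Q → Small (suc n)
  large-switches large a≡Q = large-step (subst (λ x → Odd (x + nonzero x)) (sym a≡Q) odd-weight) large
    where
    odd-weight : Odd (Q + 1)
    odd-weight = subst Odd (cong (λ x → suc (suc x)) (+-comm 1 k)) odd-q

  -- From a position N ≥ |p| where small letters are preferred, they are preferred forever;
  -- hence a is a binary word there, and each 1 is preceded by an occurrence of g.
  module Region (N : ℕ) (p≤N : P ≤ N) (small-N : Small N) where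

    small-from : ∀ d → Small (N + d)
    small-from zero    = subst Small (sym (+-identityʳ N)) small-N
    small-from (suc d) = subst Small (sym (+-suc N d))
      (small-keeps (small-from d) (small-binary (small-from d) (≤-trans p≤N (m≤m+n N d))))

    small-after : ∀ {n} → N ≤ n → Small n
    small-after N≤n = subst Small (m+[n∸m]≡n N≤n) (small-from _)

    binary-after : ∀ {n} → N ≤ n → a n ≡ 0 ⊎ a n ≡ 1
    binary-after N≤n = small-binary (small-after N≤n) (≤-trans p≤N N≤n)

    ends-after : ∀ {n} → N ≤ n → a n ≢ 0 → ¬ ¬ EndsAt g a n
    ends-after N≤n = small-ends (small-after N≤n) (≤-trans p≤N N≤n)

    -- A nonzero letter at n is followed by m zeros: a nonzero letter within distance m
    -- would end an occurrence of g, whose last m letters are 0.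
    nonzero-then-zeros : ∀ {n j} → N ≤ n + suc j → j < m → a n ≢ 0 → a (n + suc j) ≡ 0
    nonzero-then-zeros {n} {j} N≤ j<m a≢0 = decidable-stable (a (n + suc j) ≟ 0) λ a′≢0 →
      ends-after N≤ a′≢0 λ end → a≢0 (ends-replicate m (ends-suffix u end) j<m)

    marker-before-nonzero : ∀ {h x n} → u ≡ h ++ [ x ] → N ≤ n + suc m → a (n + suc m) ≢ 0 → ¬ ¬ (a n ≡ x)
    marker-before-nonzero {h} {x} u≡ N≤ a≢0 not-marker = ends-after N≤ a≢0 λ end →
      not-marker (ends-marker h x m (subst (λ v → EndsAt (v ++ replicate m 0) a _) u≡ end))

    zeros-forever : ∀ {h x s} → u ≡ h ++ [ x ] → x ≢ 0 → N ≤ s →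
      Prefix (replicate (suc m) 0) (shift s a) → ∀ d → a (s + d) ≡ 0
    zeros-forever {h} {x} {s} u≡ x≢0 N≤s run = <-rec (λ d → a (s + d) ≡ 0) step
      where
      step : ∀ d → (∀ {e} → e < d → a (s + e) ≡ 0) → a (s + d) ≡ 0
      step d earlier with d ≤? m
      ... | yes d≤m = Prefix-replicate⁻ (suc m) run d (s≤s d≤m)
      ... | no d≰m  = decidable-stable (a (s + d) ≟ 0) λ a≢0 →
        marker-before-nonzero u≡ (subst (N ≤_) position (≤-trans N≤s (m≤m+n s d)))
          (subst (λ i → a i ≢ 0) position a≢0) λ marker → x≢0 (trans (sym marker) (earlier e<d))
        where
        e = d ∸ suc m
        d≡ : e + suc m ≡ d
        d≡ = m∸n+n≡m (≰⇒> d≰m)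
        e<d : e < d
        e<d = subst (e <_) d≡ (m<m+n e (s≤s z≤n))
        position : s + d ≡ s + e + suc m
        position = trans (cong (s +_) (sym d≡)) (sym (+-assoc s e (suc m)))

    -- a contains no run of m + 1 zeros after N: if u is empty such a run is f itself,
    -- otherwise it would make a ultimately 0.
    no-zero-run : ∀ {s} → N ≤ s → ¬ Prefix (replicate (suc m) 0) (shift s a)
    no-zero-run {s} N≤s run = excluded u-shape
      where
      excluded : LastNonzero u → ⊥
      excluded (inj₁ u≡[]) = proj₂ (proj₂ cyl) s (Prefix⇒occursAt a s (subst (λ v → Prefix v (shift s a)) f≡ run))
        where
        f≡ : replicate (suc m) 0 ≡ (u ++ replicate m 0) ++ [ 0 ]
        f≡ = trans (sym (replicate-∷ʳ m 0)) (cong (λ v → (v ++ replicate m 0) ++ [ 0 ]) (sym u≡[]))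
      excluded (inj₂ (h , x , x≢0 , u≡)) = not-ultimately-0 (s , λ n s≤n →
        subst (λ i → a i ≡ 0) (m+[n∸m]≡n s≤n) (zeros-forever u≡ x≢0 N≤s run (n ∸ s)))

    zeros-after-one : ∀ {n} → N ≤ n → a n ≡ 1 → Prefix (1 ∷ replicate m 0) (shift n a)
    zeros-after-one {n} N≤n one = Prefix-∷ (trans (cong a (+-identityʳ n)) one) (Prefix-replicate⁺ m λ j j<m →
      nonzero-then-zeros (≤-trans N≤n (m≤m+n n (suc j))) j<m λ a≡0 → 1≢0 (trans (sym one) a≡0))
      where
      1≢0 : 1 ≢ 0
      1≢0 ()

    next-one : ∀ {n} → N ≤ n → a n ≡ 1 → a (n + suc m) ≡ 1
    next-one {n} N≤n one with binary-after (≤-trans N≤n (m≤m+n n (suc m)))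
    ... | inj₂ one′ = one′
    ... | inj₁ a≡0 = ⊥-elim (no-zero-run (≤-trans N≤n (n≤1+n n)) (Prefix-replicate⁺ (suc m) run))
      where
      run : ∀ j → j < suc m → a (suc n + j) ≡ 0
      run j j<sm with m≤n⇒m<n∨m≡n (≤-pred j<sm)
      ... | inj₁ j<m = trans (cong a (sym (+-suc n j))) (Prefix-replicate⁻ m (Prefix-tail (zeros-after-one N≤n one)) j j<m)
      ... | inj₂ refl = trans (cong a (sym (+-suc n j))) a≡0

    periodic-after-one : ∀ {n} → N ≤ n → a n ≡ 1 → shift n a ≐ cycleω (1 ∷ replicate m 0)
    periodic-after-one {n} N≤n one = ≐-cycleω (1 ∷ replicate m 0) (cong suc (length-replicate m)) block
      where
      N≤ : ∀ t → N ≤ n + t * suc m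
      N≤ t = ≤-trans N≤n (m≤m+n n (t * suc m))
      ones : ∀ t → a (n + t * suc m) ≡ 1
      ones zero    = trans (cong a (+-identityʳ n)) one
      ones (suc t) = trans (cong a (reassoc n m (t * suc m))) (next-one (N≤ t) (ones t))
        where
        reassoc : ∀ n m r → n + (suc m + r) ≡ n + r + suc m
        reassoc = solve-∀
      block : ∀ t → Prefix (1 ∷ replicate m 0) (shift (t * suc m) (shift n a))
      block t = Prefix-≐ (≐-sym (shift-shift n (t * suc m) a)) (zeros-after-one (N≤ t) (ones t))

    first-one-after : ∃[ t ] (t ≤ m × Prefix (replicate t 0) (shift N a) × a (N + t) ≡ 1)
    first-one-after with first-one (suc m) {shift N a} (λ j → binary-after (m≤m+n N j))
    ... | inj₁ run = ⊥-elim (no-zero-run ≤-refl run)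
    ... | inj₂ (t , t<sm , zeros , one) = t , ≤-pred t<sm , zeros , one

  prefix-p : Prefix p a
  prefix-p = hasPrefix⇒Prefix (proj₁ (proj₂ cyl))

  shape-small : Small P → ∃[ t ] (t ≤ m × a ≐ ((p ++ replicate t 0) ++ω cycleω (1 ∷ replicate m 0)))
  shape-small small with Region.first-one-after P ≤-refl small
  ... | t , t≤m , zeros , one = t , t≤m , ≐-++ω (p ++ replicate t 0) (Prefix-++ p prefix-p zeros) tail
    where
    open Region P ≤-refl small
    tail : shift (length (p ++ replicate t 0)) a ≐ cycleω (1 ∷ replicate m 0)
    tail = ≐-trans (shift-cong a (trans (length-++ p) (cong (P +_) (length-replicate t))))
                   (periodic-after-one (m≤m+n P t) one)

  shape-large : Large P → a ≐ ((p ++ [ Q ]) ++ω cycleω (replicate m 0 ++ [ 1 ]))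
  shape-large large = ≐-++ω (p ++ [ Q ]) (Prefix-++ p prefix-p (Prefix-∷ top′ (prefix λ _ ()))) tail
    where
    top = large-top large ≤-refl
    top′ : a (P + 0) ≡ Q
    top′ = trans (cong a (+-identityʳ P)) top
    open Region (suc P) (n≤1+n P) (large-switches large top)
    after-top : Prefix (replicate m 0) (shift (suc P) a) × a (suc P + m) ≡ 1
    after-top with first-one-after
    ... | t , t≤m , zeros , one with m≤n⇒m<n∨m≡n t≤m
    ...   | inj₂ refl = zeros , one
    ...   | inj₁ t<m  = ⊥-elim (1≢0 (trans (sym one) (trans (cong a (sym (+-suc P t)))
                          (nonzero-then-zeros (subst (suc P ≤_) (sym (+-suc P t)) (m≤m+n (suc P) t)) t<m Q≢0))))
      where
      1≢0 : 1 ≢ 0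
      1≢0 ()
      Q≢0 : a P ≢ 0
      Q≢0 a≡0 with trans (sym top) a≡0
      ... | ()
    len : length (replicate m 0 ++ [ 1 ]) ≡ suc m
    len = trans (length-++ (replicate m 0)) (trans (cong (_+ 1) (length-replicate m)) (+-comm m 1))
    tail : shift (length (p ++ [ Q ])) a ≐ cycleω (replicate m 0 ++ [ 1 ])
    tail = ≐-trans (shift-cong a (trans (length-++ p) (+-comm P 1)))
          (≐-trans (≐-++ω (replicate m 0) (proj₁ after-top)
                     (≐-trans (shift-shift (suc P) _ a)
                     (≐-trans (shift-cong a (cong (suc P +_) (length-replicate m)))
                              (periodic-after-one (m≤m+n (suc P) m) (proj₂ after-top)))))
                   (cycleω-rotate (replicate m 0) [ 1 ] len))

  shape : ∃[ t ] (t ≤ m × a ≐ ((p ++ replicate t 0) ++ω cycleω (1 ∷ replicate m 0)))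
          ⊎ a ≐ ((p ++ [ Q ]) ++ω cycleω (replicate m 0 ++ [ 1 ]))
  shape with small-or-large extremal P
  ... | inj₁ small = inj₁ (shape-small small)
  ... | inj₂ large = inj₂ (shape-large large)

-- Decompose g = u 0^m and read off the shape of a.
proposition3 : (q : ℕ) → 3 ≤ q → Odd q →
    (f : Word) → All (_< q) f → (∃[ g ] (f ≡ g ++ [ 0 ])) →
    ¬ InducesZeroPeriodicity q f →
    (p : Word) → FinAvoid q f p →
    (a : InfWord) → (IsFirst q f p a ⊎ IsLast q f p a) → ¬ UltPer0 a →
    ∃[ m ] ((∃[ i ] (i ≤ m × (a ≐ ((p ++ replicate i 0) ++ω cycleω (1 ∷ replicate m 0)))))
            ⊎ (a ≐ ((p ++ [ q ∸ 1 ]) ++ω cycleω (replicate m 0 ++ [ 1 ]))))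
proposition3 zero                ()
proposition3 (suc zero)          (s≤s ())
proposition3 (suc (suc zero))    (s≤s (s≤s ()))
proposition3 (suc (suc (suc k))) _ odd-q .(g ++ [ 0 ]) _ (g , refl) _ p _ a extremal not-ultimately-0
  with trailing-zeros g
... | m , u , refl , u-shape = m , Dynamics.shape k odd-q u m u-shape p a extremal not-ultimately-0
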